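{- Let $n$ people $v_1,\dots,v_n$ each initially know exactly one item of gossip (her own, all items distinct), and suppose they make calls $e_1,\dots,e_m$ in this order, where each call is an unordered pair of two distinct people and during a call each participant learns every item known by the other. Fix $i$ and suppose that $v_i$ does not hear her own gossip, i.e. there is no call $e_t$ involving $v_i$ in which the other participant already knows $v_i$'s item before $e_t$. Let $a_i$ be the number of people who know $v_i$'s item after all $m$ calls (including $v_i$), let $b_i$ be the number of items $v_i$ knows after all $m$ calls (including her own), let $d_i$ be the number of calls in which $v_i$ participates, and let $c_i$ be the number of calls that neither pass on the gossip of $v_i$ (i.e. are not calls in which exactly one participant knows $v_i$'s item beforehand) nor inform $v_i$ (i.e. do not lie on any temporal path ending at $v_i$). Then $$a_i+b_i\le m+2+d_i-c_i.$$
   Context: A temporal path from $u_0$ to $u_k$ is a sequence of calls $e_{t_1},\dots,e_{t_k}$ with $t_1<t_2<\dots<t_k$ and $e_{t_r}=\{u_{r-1},u_r\}$ for $1\le r\le k$; the gossip of $u_0$ reaches $u_k$ exactly when such a path exists (or $u_0=u_k$). A call informs $v_i$ if it is one of the calls of some temporal path ending at $v_i$. -}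

module Defs where

open import Data.Nat using (ℕ; zero; suc; _+_; _≤_; _<_)
open import Data.Bool using (Bool; true; false; if_then_else_; _∨_; _xor_; T)
import Data.Fin
import Data.List
open import Data.Fin using (Fin; _≟_)
open import Data.List using (List; []; _∷_; length; take; foldl; lookup; filter)
open import Data.List.Membership.Propositional using (_∈_)
open import Data.Product using (_×_; _,_; proj₁; proj₂; ∃; ∃-syntax)
open import Data.Sum using (_⊎_)
open import Relation.Binary.PropositionalEquality using (_≡_; _≢_)
open import Relation.Nullary using (¬_)
open import Relation.Nullary.Decidable using (⌊_⌋; T?)

-- A call is a pair of people (unordered meaning: we never use the order).
Call : ℕ → Set
Call n = Fin n × Fin n

-- Knowledge state: K x y = true iff person x knows the item of person y.
State : ℕ → Set
State n = Fin n → Fin n → Bool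

initState : ∀ {n} → State n
initState x y = ⌊ x ≟ y ⌋

step : ∀ {n} → State n → Call n → State n
step K (u , v) x y =
  if ⌊ x ≟ u ⌋ ∨ ⌊ x ≟ v ⌋ then K u y ∨ K v y else K x y

stateAfter : ∀ {n} → List (Call n) → ℕ → State n
stateAfter cs k = foldl step initState (take k cs)

finalState : ∀ {n} → List (Call n) → State n
finalState cs = foldl step initState cs

-- Time indices of the calls e_1..e_m (0-based: t ranges over Fin m).
Time : ∀ {n} → List (Call n) → Set
Time cs = Fin (length cs)

callAt : ∀ {n} (cs : List (Call n)) → Time cs → Call n
callAt cs t = lookup cs t

stateBefore : ∀ {n} (cs : List (Call n)) → Time cs → State n
stateBefore cs t = stateAfter cs (Data.Fin.toℕ t)

ProperCalls : ∀ {n} → List (Call n) → Set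
ProperCalls cs = ∀ t → proj₁ (callAt cs t) ≢ proj₂ (callAt cs t)

Joins : ∀ {n} → Call n → Fin n → Fin n → Set
Joins (a , b) u w = (a ≡ u × b ≡ w) ⊎ (a ≡ w × b ≡ u)

Involves : ∀ {n} → Call n → Fin n → Bool
Involves (a , b) x = ⌊ a ≟ x ⌋ ∨ ⌊ b ≟ x ⌋

data TPath {n} (cs : List (Call n)) : Fin n → Fin n → List (Time cs) → Set where
  one  : ∀ t {u v} → Joins (callAt cs t) u v → TPath cs u v (t ∷ [])
  more : ∀ t t' {ts u w v} → Joins (callAt cs t) u w → Data.Fin._<_ t t' →
         TPath cs w v (t' ∷ ts) → TPath cs u v (t ∷ t' ∷ ts)

Informs : ∀ {n} (cs : List (Call n)) → Time cs → Fin n → Set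
Informs cs t v = ∃[ u ] ∃[ ts ] (TPath cs u v ts × t ∈ ts)

PassesOn : ∀ {n} (cs : List (Call n)) → Time cs → Fin n → Bool
PassesOn cs t i = stateBefore cs t (proj₁ (callAt cs t)) i xor stateBefore cs t (proj₂ (callAt cs t)) i

NoHearOwn : ∀ {n} (cs : List (Call n)) → Fin n → Set
NoHearOwn cs i = ∀ t →
  (proj₁ (callAt cs t) ≡ i → stateBefore cs t (proj₂ (callAt cs t)) i ≡ false) ×
  (proj₂ (callAt cs t) ≡ i → stateBefore cs t (proj₁ (callAt cs t)) i ≡ false)

countFin : ∀ {k} → (Fin k → Bool) → ℕ
countFin {k} f = length (filter (λ j → T? (f j)) (Data.List.allFin k))

aCount : ∀ {n} → List (Call n) → Fin n → ℕ
aCount cs i = countFin (λ x → finalState cs x i)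

bCount : ∀ {n} → List (Call n) → Fin n → ℕ
bCount cs i = countFin (λ y → finalState cs i y)

dCount : ∀ {n} → List (Call n) → Fin n → ℕ
dCount cs i = countFin (λ t → Involves (callAt cs t) i)

CCall : ∀ {n} (cs : List (Call n)) → Fin n → Time cs → Set
CCall cs i t = PassesOn cs t i ≡ false × ¬ Informs cs t i

-- Fix i and follow two quantities along the calls: A t, the number of people
-- who know the item of i after the first t calls, and B t, the number of people
-- whose item reaches i through the calls from time t on.  Then A 0 = B m = 1,
-- A m = a_i and B 0 ≥ b_i.  The call at time t raises A by at most one, and only
-- if it passes on the gossip of i; it lowers B by at most one, and only if it
-- informs i.  When it does both, i takes part in it: otherwise the item of i,
-- which both participants know after the call, would travel along the temporal
-- path from that call to i and i would hear her own gossip.  Hence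
--   A (t+1) + B t + [e_t neither passes on nor informs] ≤ A t + B (t+1) + 1 + [i ∈ e_t],
-- and summing over t gives the inequality.
module Submission where

open import Defs
open import Data.Bool using (Bool; true; false; T; not; _∧_; _∨_; _xor_; if_then_else_)
open import Data.Bool.Properties using (T-∨; T-∧)
open import Data.Empty using (⊥-elim)
open import Data.Fin using (Fin; zero; suc; toℕ; _≟_)
open import Data.List
  using (List; []; _∷_; length; filter; tabulate; allFin; take; drop; foldl; lookup)
open import Data.List.Properties using (take-suc; foldl-∷ʳ; take-all; drop-all)
open import Data.List.Relation.Binary.Sublist.Propositional using (⊆-refl)
open import Data.List.Relation.Binary.Sublist.Propositional.Properties
  using (filter⁺; length-mono-≤)
open import Data.List.Relation.Unary.All as All using (All; []; _∷_)
open import Data.List.Relation.Unary.Any using (here)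
open import Data.List.Relation.Unary.Unique.Propositional using (Unique; []; _∷_)
open import Data.Nat using (ℕ; zero; suc; _+_; _≤_; z≤n; s≤s)
open import Data.Nat.Properties
  using (≤-refl; ≤-trans; ≤-reflexive; +-mono-≤; +-monoˡ-≤; +-monoʳ-≤; +-identityʳ;
         +-suc; +-assoc; +-comm; +-cancelˡ-≤; n≤1+n; +-commutativeSemigroup;
         module ≤-Reasoning)
open import Data.Nat.Tactic.RingSolver using (solve-∀)
open import Algebra.Properties.CommutativeSemigroup +-commutativeSemigroup using (interchange)
open import Data.Product using (_×_; _,_; proj₁; proj₂; ∃-syntax)
open import Data.Sum using (_⊎_; inj₁; inj₂; [_,_]′; map₂)
open import Function using (_∘_)
open import Function.Bundles using (Equivalence)
open import Relation.Binary.PropositionalEquality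
  using (_≡_; _≢_; refl; sym; trans; cong; cong₂; subst; subst₂; module ≡-Reasoning)
open import Relation.Nullary using (¬_; yes; no; does)
open import Relation.Nullary.Decidable
  using (⌊_⌋; T?; dec-true; dec-false; toWitness; fromWitness)

open Equivalence using (to; from)

𝟙 : Bool → ℕ
𝟙 false = 0
𝟙 true  = 1

𝟙-mono : ∀ {a b} → (T a → T b) → 𝟙 a ≤ 𝟙 b
𝟙-mono {false}         _   = z≤n
𝟙-mono {true} {true}   _   = ≤-refl
𝟙-mono {true} {false}  a⇒b = ⊥-elim (a⇒b _)

𝟙-T : ∀ {a} → T a → 𝟙 a ≡ 1
𝟙-T {true} _ = refl

𝟙-∨ : ∀ a b → 𝟙 (a ∨ b) ≤ 𝟙 a + 𝟙 b
𝟙-∨ true  _ = s≤s z≤n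
𝟙-∨ false _ = ≤-refl

𝟙-partition : ∀ a b → 𝟙 a + 𝟙 b + 𝟙 (not (a ∨ b)) ≡ 1 + 𝟙 (a ∧ b)
𝟙-partition true  true  = refl
𝟙-partition true  false = refl
𝟙-partition false true  = refl
𝟙-partition false false = refl

xor⇒∨ : ∀ a b → T (a xor b) → T (a ∨ b)
xor⇒∨ true  _ _ = _
xor⇒∨ false _ h = h

countFin-tabulate : ∀ {a} {A : Set a} {k} (g : Fin k → A) (p : A → Bool) →
  length (filter (T? ∘ p) (tabulate g)) ≡ countFin (p ∘ g)
countFin-tabulate {k = zero}  g p = refl
countFin-tabulate {k = suc k} g p with p (g zero)
... | true  = cong suc (trans (countFin-tabulate (g ∘ suc) p) (sym (countFin-tabulate suc (p ∘ g))))
... | false = trans (countFin-tabulate (g ∘ suc) p) (sym (countFin-tabulate suc (p ∘ g)))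

countFin-suc : ∀ {k} (f : Fin (suc k) → Bool) →
  countFin f ≡ 𝟙 (f zero) + countFin (f ∘ suc)
countFin-suc f with f zero
... | true  = cong suc (countFin-tabulate suc f)
... | false = countFin-tabulate suc f

countFin-mono : ∀ {k} {f g : Fin k → Bool} →
  (∀ x → T (f x) → T (g x)) → countFin f ≤ countFin g
countFin-mono {f = f} {g} f⊆g =
  length-mono-≤ (filter⁺ (T? ∘ f) (T? ∘ g) (λ { {x} refl → f⊆g x }) (⊆-refl {x = allFin _}))

countFin-∨ : ∀ {k} (f g : Fin k → Bool) →
  countFin (λ x → f x ∨ g x) ≤ countFin f + countFin g
countFin-∨ {zero}  f g = z≤n
countFin-∨ {suc k} f g = begin
  countFin (λ x → f x ∨ g x)
    ≡⟨ countFin-suc (λ x → f x ∨ g x) ⟩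
  𝟙 (f zero ∨ g zero) + countFin (λ x → f (suc x) ∨ g (suc x))
    ≤⟨ +-mono-≤ (𝟙-∨ (f zero) (g zero)) (countFin-∨ (f ∘ suc) (g ∘ suc)) ⟩
  (𝟙 (f zero) + 𝟙 (g zero)) + (countFin (f ∘ suc) + countFin (g ∘ suc))
    ≡⟨ interchange (𝟙 (f zero)) (𝟙 (g zero)) (countFin (f ∘ suc)) (countFin (g ∘ suc)) ⟩
  (𝟙 (f zero) + countFin (f ∘ suc)) + (𝟙 (g zero) + countFin (g ∘ suc))
    ≡⟨ sym (cong₂ _+_ (countFin-suc f) (countFin-suc g)) ⟩
  countFin f + countFin g ∎
  where open ≤-Reasoning

countFin-false : ∀ k → countFin {k} (λ _ → false) ≡ 0
countFin-false zero    = refl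
countFin-false (suc k) = trans (countFin-suc {k} (λ _ → false)) (countFin-false k)

countFin-≟ : ∀ {k} (w : Fin k) → countFin (λ x → does (x ≟ w)) ≡ 1
countFin-≟ {suc k} zero    =
  trans (countFin-suc {k} (λ x → does (x ≟ zero))) (cong suc (countFin-false k))
countFin-≟ {suc k} (suc w) =
  trans (countFin-suc {k} (λ x → does (x ≟ suc w))) (countFin-≟ w)

countFin-⊆-∪⁅⁆ : ∀ {k} {f g : Fin k → Bool} w →
  (∀ x → T (f x) → T (g x) ⊎ x ≡ w) → countFin f ≤ countFin g + 1
countFin-⊆-∪⁅⁆ {f = f} {g} w f⊆g∪w = begin
  countFin f                                 ≤⟨ countFin-mono f⊆g∨w ⟩
  countFin (λ x → g x ∨ does (x ≟ w))        ≤⟨ countFin-∨ g _ ⟩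
  countFin g + countFin (λ x → does (x ≟ w)) ≡⟨ cong (countFin g +_) (countFin-≟ w) ⟩
  countFin g + 1                             ∎
  where
  open ≤-Reasoning
  f⊆g∨w : ∀ x → T (f x) → T (g x ∨ does (x ≟ w))
  f⊆g∨w x = from T-∨ ∘ map₂ (λ x≡w → subst T (sym (dec-true (x ≟ w) x≡w)) _) ∘ f⊆g∪w x

countFin-⊆⁅⁆ : ∀ {k} {f : Fin k → Bool} w → (∀ x → T (f x) → x ≡ w) → countFin f ≤ 1
countFin-⊆⁅⁆ {k} w f⊆w =
  ≤-trans (countFin-⊆-∪⁅⁆ {g = λ _ → false} w (λ x → inj₂ ∘ f⊆w x))
          (≤-reflexive (cong (_+ 1) (countFin-false k)))

_without_ : ∀ {k} → (Fin k → Bool) → Fin k → Fin k → Bool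
(f without x) y = not (does (y ≟ x)) ∧ f y

countFin-without : ∀ {k} (f : Fin k → Bool) {x} → T (f x) →
  countFin f ≡ suc (countFin (f without x))
countFin-without {suc k} f {zero} fx = begin
  countFin f                      ≡⟨ countFin-suc f ⟩
  𝟙 (f zero) + countFin (f ∘ suc) ≡⟨ cong (_+ countFin (f ∘ suc)) (𝟙-T fx) ⟩
  suc (countFin (f ∘ suc))        ≡⟨ cong suc (sym (countFin-suc (f without zero))) ⟩
  suc (countFin (f without zero)) ∎
  where open ≡-Reasoning
countFin-without {suc k} f {suc x} fx = begin
  countFin f                                       ≡⟨ countFin-suc f ⟩
  𝟙 (f zero) + countFin (f ∘ suc)                   ≡⟨ cong (𝟙 (f zero) +_) (countFin-without (f ∘ suc) fx) ⟩
  𝟙 (f zero) + suc (countFin ((f ∘ suc) without x)) ≡⟨ +-suc _ _ ⟩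
  suc (𝟙 (f zero) + countFin ((f ∘ suc) without x)) ≡⟨ cong suc (sym (countFin-suc (f without suc x))) ⟩
  suc (countFin (f without suc x))                  ∎
  where open ≡-Reasoning

Unique⇒length≤countFin : ∀ {k} {f : Fin k → Bool} {xs} →
  Unique xs → All (T ∘ f) xs → length xs ≤ countFin f
Unique⇒length≤countFin [] [] = z≤n
Unique⇒length≤countFin {f = f} {x ∷ xs} (x∉xs ∷ unique) (fx ∷ fxs) = begin
  suc (length xs)              ≤⟨ s≤s (Unique⇒length≤countFin unique (All.zipWith kept (x∉xs , fxs))) ⟩
  suc (countFin (f without x)) ≡⟨ sym (countFin-without f fx) ⟩
  countFin f                   ∎
  where
  open ≤-Reasoning
  kept : ∀ {y} → (x ≢ y) × T (f y) → T ((f without x) y)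
  kept {y} (x≢y , fy) rewrite dec-false (y ≟ x) (x≢y ∘ sym) = fy

-- The potential f − r grows by at most 1 + [h t] − [g t] per step; both the step
-- and the total are written with the terms moved so that no subtraction occurs.
countFin-telescope : ∀ m (f r : ℕ → ℕ) (g h : Fin m → Bool) →
  (∀ t → f (suc (toℕ t)) + r (toℕ t) + 𝟙 (g t) ≤ f (toℕ t) + r (suc (toℕ t)) + 1 + 𝟙 (h t)) →
  f m + r 0 + countFin g ≤ f 0 + r m + m + countFin h
countFin-telescope zero    f r g h _    = ≤-reflexive (sym (+-identityʳ _))
countFin-telescope (suc m) f r g h step
  rewrite countFin-suc g | countFin-suc h =
    +-cancelˡ-≤ (f 1 + r 1) _ _
      (subst₂ _≤_
        (regroupˡ (f 1) (r 0) (𝟙 (g zero)) (f (suc m)) (r 1) (countFin (g ∘ suc)))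
        (regroupʳ (f 0) (r 1) (𝟙 (h zero)) (f 1) (r (suc m)) m (countFin (h ∘ suc)))
        (+-mono-≤ (step zero) rest))
  where
  rest = countFin-telescope m (f ∘ suc) (r ∘ suc) (g ∘ suc) (h ∘ suc) (step ∘ suc)
  regroupˡ : ∀ f₁ r₀ g₀ fₘ r₁ gs →
    f₁ + r₀ + g₀ + (fₘ + r₁ + gs) ≡ f₁ + r₁ + (fₘ + r₀ + (g₀ + gs))
  regroupˡ = solve-∀
  regroupʳ : ∀ f₀ r₁ h₀ f₁ rₘ m hs →
    f₀ + r₁ + 1 + h₀ + (f₁ + rₘ + m + hs) ≡ f₁ + r₁ + (f₀ + rₘ + suc m + (h₀ + hs))
  regroupʳ = solve-∀

drop-lookup : ∀ {a} {A : Set a} (xs : List A) (τ : Fin (length xs)) →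
  drop (toℕ τ) xs ≡ lookup xs τ ∷ drop (suc (toℕ τ)) xs
drop-lookup (x ∷ xs) zero    = refl
drop-lookup (x ∷ xs) (suc τ) = drop-lookup xs τ

drop≡∷⇒lookup : ∀ {a} {A : Set a} (xs : List A) s {y ys} → drop s xs ≡ y ∷ ys →
  ∃[ τ ] (toℕ τ ≡ s × lookup xs τ ≡ y × drop (suc s) xs ≡ ys)
drop≡∷⇒lookup []       zero    ()
drop≡∷⇒lookup []       (suc s) ()
drop≡∷⇒lookup (x ∷ xs) zero    refl = zero , refl , refl , refl
drop≡∷⇒lookup (x ∷ xs) (suc s) eq with drop≡∷⇒lookup xs s eq
... | τ , refl , y≡ , ys≡ = suc τ , refl , y≡ , ys≡

module _ {n : ℕ} where

  Joins-sym : ∀ {c : Call n} {x z} → Joins c x z → Joins c z x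
  Joins-sym (inj₁ (a , b)) = inj₂ (a , b)
  Joins-sym (inj₂ (a , b)) = inj₁ (a , b)

  Joins⇒Involves : ∀ {c : Call n} {x z} → Joins c x z → T (Involves c x)
  Joins⇒Involves {u , v} (inj₁ (refl , _)) = from T-∨ (inj₁ (fromWitness {a? = u ≟ u} refl))
  Joins⇒Involves {u , v} (inj₂ (_ , refl)) = from T-∨ (inj₂ (fromWitness {a? = v ≟ v} refl))

  ∨-participant : ∀ (R : Fin n → Bool) (c : Call n) →
    T (R (proj₁ c) ∨ R (proj₂ c)) → ∃[ x ] ∃[ z ] (Joins c x z × T (R x))
  ∨-participant R (u , v) h with to (T-∨ {R u} {R v}) h
  ... | inj₁ Ru = _ , _ , inj₁ (refl , refl) , Ru
  ... | inj₂ Rv = _ , _ , inj₂ (refl , refl) , Rv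

  -- step K c x y = spread (λ z → K z y) c x by definition: each column of a
  -- knowledge state evolves by spread.
  spread : (Fin n → Bool) → Call n → Fin n → Bool
  spread R (u , v) x = if ⌊ x ≟ u ⌋ ∨ ⌊ x ≟ v ⌋ then R u ∨ R v else R x

  spread-⊇ : ∀ R c {x} → T (R x) → T (spread R c x)
  spread-⊇ R (u , v) {x} Rx with x ≟ u | x ≟ v
  ... | yes refl | _        = from T-∨ (inj₁ Rx)
  ... | no _     | yes refl = from T-∨ (inj₂ Rx)
  ... | no _     | no _     = Rx

  spread-joins : ∀ R {c : Call n} {x z} → Joins c x z → T (R z) → T (spread R c x)
  spread-joins R {u , v} (inj₁ (refl , refl)) Rv with u ≟ u
  ... | yes _  = from T-∨ (inj₂ Rv)
  ... | no u≢u = ⊥-elim (u≢u refl)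
  spread-joins R {u , v} (inj₂ (refl , refl)) Ru with v ≟ u | v ≟ v
  ... | yes _ | _      = from T-∨ (inj₁ Ru)
  ... | no _  | yes _  = from T-∨ (inj₁ Ru)
  ... | no _  | no v≢v = ⊥-elim (v≢v refl)

  spread-participant : ∀ R {c : Call n} {x z} → Joins c x z →
    T (R (proj₁ c) ∨ R (proj₂ c)) → T (spread R c x)
  spread-participant R {u , v} j h with to (T-∨ {R u} {R v}) h | j
  ... | inj₁ Ru | inj₁ (refl , refl) = spread-⊇ R (u , v) Ru
  ... | inj₂ Rv | inj₁ (refl , refl) = spread-joins R j Rv
  ... | inj₁ Ru | inj₂ (refl , refl) = spread-joins R j Ru
  ... | inj₂ Rv | inj₂ (refl , refl) = spread-⊇ R (u , v) Rv

  spread-cases : ∀ (R : Fin n → Bool) (c : Call n) {x} →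
    T (spread R c x) → T (R x) ⊎ ∃[ z ] (Joins c x z × T (R z))
  spread-cases R (u , v) {x} h with x ≟ u | x ≟ v
  ... | yes refl | _        = map₂ (λ Rv → v , inj₁ (refl , refl) , Rv) (to T-∨ h)
  ... | no _     | yes refl = [ (λ Ru → inj₂ (u , inj₂ (refl , refl) , Ru)) , inj₁ ]′ (to T-∨ h)
  ... | no _     | no _     = inj₁ h

  spread-⊆ : ∀ R {u v} → R u ≡ R v → ∀ x → T (spread R (u , v) x) → T (R x)
  spread-⊆ R Ru≡Rv x h with spread-cases R _ h
  ... | inj₁ Rx                            = Rx
  ... | inj₂ (_ , inj₁ (refl , refl) , Rv) = subst T (sym Ru≡Rv) Rv
  ... | inj₂ (_ , inj₂ (refl , refl) , Ru) = subst T Ru≡Rv Ru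

  spread-⊆-∪⁅⁆ : ∀ R {c : Call n} {p q} → Joins c p q → T (R p) →
    ∀ x → T (spread R c x) → T (R x) ⊎ x ≡ q
  spread-⊆-∪⁅⁆ R {u , v} pq Rp x h with spread-cases R (u , v) h | pq
  ... | inj₁ Rx                           | _                  = inj₁ Rx
  ... | inj₂ (_ , inj₁ (refl , refl) , _) | inj₁ (refl , refl) = inj₁ Rp
  ... | inj₂ (_ , inj₂ (refl , refl) , _) | inj₁ (refl , refl) = inj₂ refl
  ... | inj₂ (_ , inj₁ (refl , refl) , _) | inj₂ (refl , refl) = inj₂ refl
  ... | inj₂ (_ , inj₂ (refl , refl) , _) | inj₂ (refl , refl) = inj₁ Rp

  spread-count : ∀ R {u v} → countFin (spread R (u , v)) ≤ countFin R + 𝟙 (R u xor R v)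
  spread-count R {u} {v} = bound (R u) (R v) refl refl
    where
    unchanged : R u ≡ R v → countFin (spread R (u , v)) ≤ countFin R + 0
    unchanged Ru≡Rv =
      ≤-trans (countFin-mono (spread-⊆ R Ru≡Rv)) (≤-reflexive (sym (+-identityʳ _)))
    bound : ∀ a b → R u ≡ a → R v ≡ b →
      countFin (spread R (u , v)) ≤ countFin R + 𝟙 (a xor b)
    bound true  true  Ru Rv = unchanged (trans Ru (sym Rv))
    bound false false Ru Rv = unchanged (trans Ru (sym Rv))
    bound true  false Ru _  =
      countFin-⊆-∪⁅⁆ v (spread-⊆-∪⁅⁆ R (inj₁ (refl , refl)) (subst T (sym Ru) _))
    bound false true  _  Rv =
      countFin-⊆-∪⁅⁆ u (spread-⊆-∪⁅⁆ R (inj₂ (refl , refl)) (subst T (sym Rv) _))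

  foldl-step-inflationary : ∀ l (K : State n) {x y} → T (K x y) → T (foldl step K l x y)
  foldl-step-inflationary []      K         Kxy = Kxy
  foldl-step-inflationary (c ∷ l) K {y = y} Kxy =
    foldl-step-inflationary l (step K c) (spread-⊇ (λ w → K w y) c Kxy)

  foldl-step-take-mono : ∀ l (K : State n) {s s' x y} → s ≤ s' →
    T (foldl step K (take s l) x y) → T (foldl step K (take s' l) x y)
  foldl-step-take-mono l       K {zero}  {s'}     _          = foldl-step-inflationary (take s' l) K
  foldl-step-take-mono []      K {suc s} {suc s'} _          = λ k → k
  foldl-step-take-mono (c ∷ l) K {suc s} {suc s'} (s≤s s≤s') = foldl-step-take-mono l (step K c) s≤s'

  stateAfter-mono : ∀ (cs : List (Call n)) {s s' x y} → s ≤ s' →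
    T (stateAfter cs s x y) → T (stateAfter cs s' x y)
  stateAfter-mono cs = foldl-step-take-mono cs initState

  stateAfter-suc : ∀ (cs : List (Call n)) τ →
    stateAfter cs (suc (toℕ τ)) ≡ step (stateBefore cs τ) (callAt cs τ)
  stateAfter-suc cs τ = trans (cong (foldl step initState) (take-suc cs τ))
                              (foldl-∷ʳ step initState (callAt cs τ) (take (toℕ τ) cs))

  stateAfter-length : ∀ (cs : List (Call n)) → stateAfter cs (length cs) ≡ finalState cs
  stateAfter-length cs = cong (foldl step initState) (take-all (length cs) cs ≤-refl)

  -- The people whose gossip reaches i through the calls l, found by spreading
  -- backwards from the last call.
  reachers : Fin n → List (Call n) → Fin n → Bool
  reachers i []      y = ⌊ y ≟ i ⌋
  reachers i (c ∷ l)   = spread (reachers i l) c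

  knows⇒reaches : ∀ l (K : State n) {x y} →
    T (foldl step K l x y) → ∃[ z ] (T (reachers x l z) × T (K z y))
  knows⇒reaches []      K {x} Kxy = x , fromWitness refl , Kxy
  knows⇒reaches (c ∷ l) K {y = y} k with knows⇒reaches l (step K c) k
  ... | z , Rz , k′ with spread-cases (λ w → K w y) c k′
  ...   | inj₁ Kzy           = z , spread-⊇ (reachers _ l) c Rz , Kzy
  ...   | inj₂ (w , j , Kwy) = w , spread-joins (reachers _ l) (Joins-sym j) Rz , Kwy

  finalState⇒reachers : ∀ (cs : List (Call n)) {i y} →
    T (finalState cs i y) → T (reachers i cs y)
  finalState⇒reachers cs k with knows⇒reaches cs initState k
  ... | z , Rz , z≟y with toWitness z≟y
  ... | refl = Rz

module _ {n : ℕ} (cs : List (Call n)) (i : Fin n) where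

  Reaches : ℕ → Fin n → Set
  Reaches s y = y ≡ i ⊎ ∃[ t ] ∃[ ts ] (s ≤ toℕ t × TPath cs y i (t ∷ ts))

  Reaches-weaken : ∀ {s s' y} → s ≤ s' → Reaches s' y → Reaches s y
  Reaches-weaken _    (inj₁ y≡i)                 = inj₁ y≡i
  Reaches-weaken s≤s' (inj₂ (t , ts , s'≤t , p)) = inj₂ (t , ts , ≤-trans s≤s' s'≤t , p)

  Reaches-prepend : ∀ t {x y} → Joins (callAt cs t) x y → Reaches (suc (toℕ t)) y →
    ∃[ ts ] TPath cs x i (t ∷ ts)
  Reaches-prepend t j (inj₁ refl)                 = [] , one t j
  Reaches-prepend t j (inj₂ (t' , ts , t<t' , p)) = t' ∷ ts , more t t' j t<t' p

  reachers-sound : ∀ s l {y} → drop s cs ≡ l → T (reachers i l y) → Reaches s y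
  reachers-sound s []      _  y≟i = inj₁ (toWitness y≟i)
  reachers-sound s (c ∷ l) d≡ h with drop≡∷⇒lookup cs s d≡
  ... | τ , refl , refl , d≡′ with spread-cases (reachers i l) (callAt cs τ) h
  ...   | inj₁ Ry           = Reaches-weaken (n≤1+n _) (reachers-sound _ l d≡′ Ry)
  ...   | inj₂ (z , j , Rz) = inj₂ (τ , proj₁ path , ≤-refl , proj₂ path)
    where path = Reaches-prepend τ j (reachers-sound _ l d≡′ Rz)

  partner-ignorant : NoHearOwn cs i → ∀ t {x} → Joins (callAt cs t) x i →
    ¬ T (stateBefore cs t x i)
  partner-ignorant nho t (inj₁ (refl , e)) k = subst T (proj₂ (nho t) e) k
  partner-ignorant nho t (inj₂ (e , refl)) k = subst T (proj₁ (nho t) e) k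

  -- Otherwise the item of i would travel along the path to the partner of i in its last call.
  path-source-ignorant : NoHearOwn cs i → ∀ {t ts x} → TPath cs x i (t ∷ ts) →
    ¬ T (stateBefore cs t x i)
  path-source-ignorant nho (one t j)            k = partner-ignorant nho t j k
  path-source-ignorant nho (more t t' j t<t' p) k =
    path-source-ignorant nho p (stateAfter-mono cs t<t' partner-knows)
    where
    partner-knows = subst (λ K → T (K _ i)) (sym (stateAfter-suc cs t))
                          (spread-joins (λ w → stateBefore cs t w i) (Joins-sym j) k)

  knows-Reaches⇒≡ : NoHearOwn cs i → ∀ {s y} → T (stateAfter cs s y i) → Reaches s y → y ≡ i
  knows-Reaches⇒≡ nho _ (inj₁ y≡i)                = y≡i
  knows-Reaches⇒≡ nho k (inj₂ (t , ts , s≤t , p)) =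
    ⊥-elim (path-source-ignorant nho p (stateAfter-mono cs s≤t k))

  reachersAfter : Time cs → Fin n → Bool
  reachersAfter τ = reachers i (drop (suc (toℕ τ)) cs)

  informsᵇ : Time cs → Bool
  informsᵇ τ = reachersAfter τ (proj₁ (callAt cs τ)) ∨ reachersAfter τ (proj₂ (callAt cs τ))

  informsᵇ⇒Informs : ∀ τ → T (informsᵇ τ) → Informs cs τ i
  informsᵇ⇒Informs τ h with ∨-participant (reachersAfter τ) (callAt cs τ) h
  ... | x , z , j , Rx with Reaches-prepend τ (Joins-sym j) (reachers-sound _ _ refl Rx)
  ...   | ts , p = z , τ ∷ ts , p , here refl

  knows-after-passing : ∀ τ {x z} → T (PassesOn cs τ i) → Joins (callAt cs τ) x z →
    T (stateAfter cs (suc (toℕ τ)) x i)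
  knows-after-passing τ {x} pass j = subst (λ K → T (K x i)) (sym (stateAfter-suc cs τ))
    (spread-participant K j (xor⇒∨ (K (proj₁ (callAt cs τ))) (K (proj₂ (callAt cs τ))) pass))
    where K = λ w → stateBefore cs τ w i

  passes∧informs⇒involves : NoHearOwn cs i → ∀ τ →
    T (PassesOn cs τ i) → T (informsᵇ τ) → T (Involves (callAt cs τ) i)
  passes∧informs⇒involves nho τ pass h with ∨-participant (reachersAfter τ) (callAt cs τ) h
  ... | x , z , j , Rx = subst (λ w → T (Involves (callAt cs τ) w)) x≡i (Joins⇒Involves j)
    where
    x≡i = knows-Reaches⇒≡ nho (knows-after-passing τ pass j)
                              (reachers-sound (suc (toℕ τ)) _ refl Rx)

  informed : ℕ → ℕ
  informed s = countFin (λ x → stateAfter cs s x i)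

  reaching : ℕ → ℕ
  reaching s = countFin (reachers i (drop s cs))

  quiet : Time cs → Bool
  quiet τ = not (PassesOn cs τ i ∨ informsᵇ τ)

  informed-step : ∀ τ → informed (suc (toℕ τ)) ≤ informed (toℕ τ) + 𝟙 (PassesOn cs τ i)
  informed-step τ =
    ≤-trans (≤-reflexive (cong (λ K → countFin (λ x → K x i)) (stateAfter-suc cs τ)))
            (spread-count (λ x → stateBefore cs τ x i))

  reaching-step : ∀ τ → reaching (toℕ τ) ≤ reaching (suc (toℕ τ)) + 𝟙 (informsᵇ τ)
  reaching-step τ = begin
    reaching (toℕ τ)                         ≡⟨ cong (countFin ∘ reachers i) (drop-lookup cs τ) ⟩
    countFin (spread R (callAt cs τ))        ≤⟨ spread-count R ⟩
    reaching (suc (toℕ τ)) + 𝟙 (R u xor R v) ≤⟨ +-monoʳ-≤ _ (𝟙-mono (xor⇒∨ (R u) (R v))) ⟩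
    reaching (suc (toℕ τ)) + 𝟙 (informsᵇ τ)  ∎
    where
    open ≤-Reasoning
    R = reachersAfter τ
    u = proj₁ (callAt cs τ)
    v = proj₂ (callAt cs τ)

  potential-step : NoHearOwn cs i → ∀ τ → let t = toℕ τ in
    informed (suc t) + reaching t + 𝟙 (quiet τ)
      ≤ informed t + reaching (suc t) + 1 + 𝟙 (Involves (callAt cs τ) i)
  potential-step nho τ = begin
    informed (suc t) + reaching t + 𝟙 (quiet τ)
      ≤⟨ +-monoˡ-≤ _ (+-mono-≤ (informed-step τ) (reaching-step τ)) ⟩
    (informed t + 𝟙 P) + (reaching (suc t) + 𝟙 G) + 𝟙 (quiet τ)
      ≡⟨ cong (_+ 𝟙 (quiet τ)) (interchange (informed t) (𝟙 P) (reaching (suc t)) (𝟙 G)) ⟩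
    (informed t + reaching (suc t)) + (𝟙 P + 𝟙 G) + 𝟙 (quiet τ)
      ≡⟨ +-assoc (informed t + reaching (suc t)) _ _ ⟩
    informed t + reaching (suc t) + (𝟙 P + 𝟙 G + 𝟙 (quiet τ))
      ≡⟨ cong (informed t + reaching (suc t) +_) (𝟙-partition P G) ⟩
    informed t + reaching (suc t) + (1 + 𝟙 (P ∧ G))
      ≤⟨ +-monoʳ-≤ (informed t + reaching (suc t)) (+-monoʳ-≤ 1 (𝟙-mono both⇒involves)) ⟩
    informed t + reaching (suc t) + (1 + 𝟙 (Involves (callAt cs τ) i))
      ≡⟨ sym (+-assoc (informed t + reaching (suc t)) 1 _) ⟩
    informed t + reaching (suc t) + 1 + 𝟙 (Involves (callAt cs τ) i) ∎
    where
    open ≤-Reasoning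
    t = toℕ τ
    P = PassesOn cs τ i
    G = informsᵇ τ
    both⇒involves : T (P ∧ G) → T (Involves (callAt cs τ) i)
    both⇒involves PG = passes∧informs⇒involves nho τ (proj₁ (to T-∧ PG)) (proj₂ (to T-∧ PG))

  CCall⇒quiet : ∀ {τ} → CCall cs i τ → T (quiet τ)
  CCall⇒quiet {τ} (silent , ¬informs) rewrite silent with informsᵇ τ in G
  ... | true  = ¬informs (informsᵇ⇒Informs τ (subst T (sym G) _))
  ... | false = _

  aCount≡informed-final : aCount cs i ≡ informed (length cs)
  aCount≡informed-final = cong (λ K → countFin (λ x → K x i)) (sym (stateAfter-length cs))

  bCount≤reaching-initial : bCount cs i ≤ reaching 0
  bCount≤reaching-initial =
    countFin-mono {f = finalState cs i} {reachers i cs} (λ y → finalState⇒reachers cs)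

  informed-initial≤1 : informed 0 ≤ 1
  informed-initial≤1 = countFin-⊆⁅⁆ i (λ x → toWitness)

  reaching-final≤1 : reaching (length cs) ≤ 1
  reaching-final≤1 rewrite drop-all (length cs) cs ≤-refl = countFin-⊆⁅⁆ i (λ x → toWitness)

mainTheorem3 : (n : ℕ) (cs : List (Call n)) → ProperCalls cs → (i : Fin n) →
    NoHearOwn cs i →
    (C : List (Time cs)) → Unique C → All (CCall cs i) C →
    aCount cs i + bCount cs i + length C ≤ length cs + 2 + dCount cs i
mainTheorem3 n cs _ i nho C unique C-counted = begin
  aCount cs i + bCount cs i + length C
    ≤⟨ +-mono-≤ (+-mono-≤ (≤-reflexive (aCount≡informed-final cs i)) (bCount≤reaching-initial cs i))
                (Unique⇒length≤countFin unique (All.map (CCall⇒quiet cs i) C-counted)) ⟩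
  informed cs i m + reaching cs i 0 + countFin (quiet cs i)
    ≤⟨ countFin-telescope m (informed cs i) (reaching cs i) (quiet cs i)
                          (λ τ → Involves (callAt cs τ) i) (potential-step cs i nho) ⟩
  informed cs i 0 + reaching cs i m + m + dCount cs i
    ≤⟨ +-monoˡ-≤ (dCount cs i)
         (+-monoˡ-≤ m (+-mono-≤ (informed-initial≤1 cs i) (reaching-final≤1 cs i))) ⟩
  2 + m + dCount cs i
    ≡⟨ cong (_+ dCount cs i) (+-comm 2 m) ⟩
  m + 2 + dCount cs i ∎
  where
  open ≤-Reasoning
  m = length cs
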